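{- Let $0\leq k\leq n-3$ and let $G$ be a connected graph on $n$ vertices with exactly $k$ cut vertices, $G\not\cong K_{1,3}$. Let $B$ be a block of $G$. Then for any $u,v\in V(B)$, $f_G(u,v)\geq 2(n-k)-1$.
   Context: All graphs are simple, finite, undirected. $f_G(u,v)$ is the number of connected subgraphs of $G$ containing both $u$ and $v$ (connected subgraphs: nonempty subgraphs, i.e. vertex subsets with subsets of edges among them, that are connected; distinct subgraphs counted separately). A block is a maximal 2-connected subgraph or a bridge. -}

module Defs where

open import Data.Nat using (ℕ; zero; suc; _+_; _*_; _∸_; _≤_)
open import Data.Bool using (Bool; true; false; T)
open import Data.Fin using (Fin; zero; suc)
open import Data.Fin.Subset using (Subset; _∈_; ∣_∣)
open import Data.Vec using (Vec; lookup)
open import Data.Product using (Σ; ∃; _×_; _,_)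
open import Data.Sum using (_⊎_)
open import Data.Empty using (⊥)
open import Relation.Nullary using (¬_)
open import Relation.Binary.PropositionalEquality using (_≡_; _≢_)
open import Function.Bundles using (_↔_; Inverse)

record Graph (n : ℕ) : Set where
  field
    adj   : Fin n → Fin n → Bool
    sym   : ∀ x y → adj x y ≡ adj y x
    irr   : ∀ x → adj x x ≡ false

open Graph public

Adj : ∀ {n} → Graph n → Fin n → Fin n → Set
Adj G x y = T (adj G x y)

data Walk {n : ℕ} (R : Fin n → Fin n → Set) : Fin n → Fin n → Set where
  here : ∀ {x} → Walk R x x
  step : ∀ {x y z} → R x y → Walk R y z → Walk R x z

ConnectedGraph : ∀ {n} → Graph n → Set
ConnectedGraph G = ∀ x y → Walk (Adj G) x y

IsCutVertex : ∀ {n} → Graph n → Fin n → Set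
IsCutVertex G w =
  ∃ λ x → ∃ λ y → x ≢ w × y ≢ w ×
    ¬ Walk (λ a b → a ≢ w × b ≢ w × Adj G a b) x y

HasExactlyCutVertices : ∀ {n} → Graph n → ℕ → Set
HasExactlyCutVertices {n} G k =
  Σ (Subset n) λ C → ∣ C ∣ ≡ k × (∀ w → (w ∈ C → IsCutVertex G w) × (IsCutVertex G w → w ∈ C))

IsBridge : ∀ {n} → Graph n → Fin n → Fin n → Set
IsBridge G x y =
  Adj G x y ×
  ¬ Walk (λ a b → Adj G a b × ¬ ((a ≡ x × b ≡ y) ⊎ (a ≡ y × b ≡ x))) x y

-- Subgraphs: a vertex set and a (symmetric) edge set given as an
-- adjacency matrix of Booleans.  Two subgraphs are equal iff these data
-- are equal.

record Sub (n : ℕ) : Set where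
  constructor sub
  field
    verts : Subset n
    edges : Vec (Subset n) n

open Sub public

Edge : ∀ {n} → Sub n → Fin n → Fin n → Set
Edge H x y = y ∈ lookup (edges H) x

IsSubgraph : ∀ {n} → Graph n → Sub n → Set
IsSubgraph G H =
  ∀ x y → Edge H x y → Adj G x y × Edge H y x × x ∈ verts H × y ∈ verts H

SubOf : ∀ {n} → Sub n → Sub n → Set
SubOf H H' = (∀ x → x ∈ verts H → x ∈ verts H') × (∀ x y → Edge H x y → Edge H' x y)

ConnectedSub : ∀ {n} → Sub n → Set
ConnectedSub H =
  (∃ λ x → x ∈ verts H) ×
  (∀ x y → x ∈ verts H → y ∈ verts H → Walk (Edge H) x y)

TwoConnected : ∀ {n} → Sub n → Set
TwoConnected H =
  3 ≤ ∣ verts H ∣ × ConnectedSub H ×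
  (∀ w → w ∈ verts H → ∀ x y → x ∈ verts H → y ∈ verts H → x ≢ w → y ≢ w →
     Walk (λ a b → Edge H a b × a ≢ w × b ≢ w) x y)

MaxTwoConnected : ∀ {n} → Graph n → Sub n → Set
MaxTwoConnected G H =
  IsSubgraph G H × TwoConnected H ×
  (∀ H' → IsSubgraph G H' → TwoConnected H' → SubOf H H' → H' ≡ H)

BridgeSub : ∀ {n} → Graph n → Sub n → Set
BridgeSub G H =
  ∃ λ x → ∃ λ y → IsBridge G x y ×
    (∀ z → (z ∈ verts H → (z ≡ x ⊎ z ≡ y)) × ((z ≡ x ⊎ z ≡ y) → z ∈ verts H)) ×
    (∀ a b → (Edge H a b → ((a ≡ x × b ≡ y) ⊎ (a ≡ y × b ≡ x))) ×
             (((a ≡ x × b ≡ y) ⊎ (a ≡ y × b ≡ x)) → Edge H a b))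

IsBlock : ∀ {n} → Graph n → Sub n → Set
IsBlock G B = MaxTwoConnected G B ⊎ BridgeSub G B

Iso : ∀ {n m} → Graph n → Graph m → Set
Iso {n} {m} G H =
  Σ (Fin n ↔ Fin m) λ σ → ∀ x y → adj G x y ≡ adj H (Inverse.to σ x) (Inverse.to σ y)

starAdj : Fin 4 → Fin 4 → Bool
starAdj zero zero = false
starAdj zero (suc _) = true
starAdj (suc _) zero = true
starAdj (suc _) (suc _) = false

starSym : ∀ x y → starAdj x y ≡ starAdj y x
starSym zero zero = Relation.Binary.PropositionalEquality.refl
starSym zero (suc _) = Relation.Binary.PropositionalEquality.refl
starSym (suc _) zero = Relation.Binary.PropositionalEquality.refl
starSym (suc _) (suc _) = Relation.Binary.PropositionalEquality.refl

starIrr : ∀ x → starAdj x x ≡ false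
starIrr zero = Relation.Binary.PropositionalEquality.refl
starIrr (suc _) = Relation.Binary.PropositionalEquality.refl

K13 : Graph 4
K13 = record { adj = starAdj ; sym = starSym ; irr = starIrr }

-- f_G(u,v) ≥ m : there are at least m distinct connected subgraphs of G
-- containing both u and v (an injective family indexed by Fin m)

ConnSubsThroughAtLeast : ∀ {n} → Graph n → Fin n → Fin n → ℕ → Set
ConnSubsThroughAtLeast {n} G u v m =
  Σ (Fin m → Sub n) λ F →
    (∀ i j → F i ≡ F j → i ≡ j) ×
    (∀ i → IsSubgraph G (F i) × ConnectedSub (F i) × u ∈ verts (F i) × v ∈ verts (F i))

-- Call a vertex pendant if it is a non-cut leaf other than u and v, and inner if it is a non-cut
-- vertex of degree at least 2.  Removing any set S of pendant vertices keeps G connected, and so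
-- does removing, in addition, one edge at an inner vertex w (reroute through another neighbour of
-- w and then inside G - w); removing a single inner vertex other than u, v keeps G connected as
-- well.  All these subgraphs contain u and v and are pairwise distinct.  Orienting the edges at
-- inner vertices shows that at least as many such edges exist as there are inner vertices.  With
-- a pendant vertices, m inner vertices other than u, v and c non-cut vertices among u, v, so that
-- n - k = c + a + m, this gives 2^a (1 + d) + m subgraphs, where d is at least the number of inner
-- vertices, and this is at least 2(n - k) - 1 except when u, say, is a non-cut leaf, a = 2 and
-- m = 0.  Then the block of u is the bridge uv (or u = v), and the subgraph on {u, v} is a further
-- member of the family unless all other vertices are pendant, which forces G to be K_{1,3}.

module Submission where

open import Data.Bool using (T)
open import Data.Bool.Properties using (T?; T-≡; ¬-not)
open import Data.Empty using (⊥-elim)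
open import Data.Fin as Fin using (Fin; zero; suc)
open import Data.Fin.Properties as Fin using ()
import Data.Fin.Permutation as Perm
open import Data.Fin.Subset
open import Data.Fin.Subset.Properties
open import Data.List as List using (List; []; _∷_; _++_; map; length)
open import Data.List.Properties using (length-map; length-++)
open import Data.List.Membership.Propositional as List using ()
open import Data.List.Membership.Propositional.Properties using (∈-map⁻; ∈-++⁻; ∈-lookup; ∈-allFin)
open import Data.List.Relation.Binary.Disjoint.Propositional using (Disjoint)
open import Data.List.Relation.Unary.All as All using (All; []; _∷_)
open import Data.List.Relation.Unary.All.Properties as All using ()
open import Data.List.Relation.Unary.AllPairs using ([]; _∷_)
open import Data.List.Relation.Unary.Any as Any using ()
open import Data.List.Relation.Unary.Unique.Propositional using (Unique)
open import Data.List.Relation.Unary.Unique.Propositional.Properties as Unique using ()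
open import Data.Maybe using (Maybe; just; nothing)
open import Data.Maybe.Properties as Maybe using ()
open import Data.Maybe.Relation.Unary.All as Maybe using (just; nothing)
open import Data.Nat as ℕ using (ℕ; zero; suc; _+_; _*_; _∸_; _^_; _≤_; _<_; z≤n; s≤s)
open import Data.Nat.Properties as ℕ using ()
open import Algebra.Properties.CommutativeSemigroup ℕ.+-commutativeSemigroup
  using (x∙yz≈y∙xz) renaming (interchange to +-interchange)
open import Data.Product as Product using (Σ; ∃; _×_; _,_; proj₁; proj₂)
open import Data.Sum as Sum using (_⊎_; inj₁; inj₂)
open import Data.Unit using (tt) renaming (⊤ to Unit)
open import Data.Vec using ([]; _∷_; tabulate; here; there)
open import Data.Vec.Properties using (lookup∘tabulate; []=⇒lookup; lookup⇒[]=; ∷-injectiveʳ)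
open import Function using (_∘_; _$_; case_of_; flip; id)
open import Function.Bundles using (Equivalence)
open import Level using (Level)
open import Relation.Binary.PropositionalEquality
open import Relation.Nullary using (¬_; Dec; yes; no; does; contradiction)
open import Relation.Nullary.Decidable as Dec using (_×-dec_; _⊎-dec_; dec-true)
open import Relation.Unary using (Pred; Decidable)

open import Defs hiding (sym)

private variable
  a ℓ : Level
  A B : Set a
  n : ℕ
  p q : Subset n
  u v w x y z : Fin n

⟦_⟧ : {P : Pred (Fin n) ℓ} → Decidable P → Subset n
⟦ P? ⟧ = tabulate (does ∘ P?)

module _ {P : Pred (Fin n) ℓ} (P? : Decidable P) where

  ∈⟦⟧⁺ : P x → x ∈ ⟦ P? ⟧
  ∈⟦⟧⁺ {x} px = lookup⇒[]= x ⟦ P? ⟧ (trans (lookup∘tabulate (does ∘ P?) x) (dec-true (P? x) px))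

  ∈⟦⟧⁻ : x ∈ ⟦ P? ⟧ → P x
  ∈⟦⟧⁻ {x} x∈ with P? x | trans (sym (lookup∘tabulate (does ∘ P?) x)) ([]=⇒lookup x∈)
  ... | yes px | _ = px

∣p∣≡∣p∩q∣+∣p─q∣ : ∀ (p q : Subset n) → ∣ p ∣ ≡ ∣ p ∩ q ∣ + ∣ p ─ q ∣
∣p∣≡∣p∩q∣+∣p─q∣ []            []            = refl
∣p∣≡∣p∩q∣+∣p─q∣ (outside ∷ p) (inside  ∷ q) = ∣p∣≡∣p∩q∣+∣p─q∣ p q
∣p∣≡∣p∩q∣+∣p─q∣ (outside ∷ p) (outside ∷ q) = ∣p∣≡∣p∩q∣+∣p─q∣ p q
∣p∣≡∣p∩q∣+∣p─q∣ (inside  ∷ p) (inside  ∷ q) = cong suc (∣p∣≡∣p∩q∣+∣p─q∣ p q)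
∣p∣≡∣p∩q∣+∣p─q∣ (inside  ∷ p) (outside ∷ q) =
  trans (cong suc (∣p∣≡∣p∩q∣+∣p─q∣ p q)) (sym (ℕ.+-suc _ _))

∣p∪q∣≤∣p∣+∣q∣ : ∀ (p q : Subset n) → ∣ p ∪ q ∣ ≤ ∣ p ∣ + ∣ q ∣
∣p∪q∣≤∣p∣+∣q∣ []            []            = z≤n
∣p∪q∣≤∣p∣+∣q∣ (outside ∷ p) (outside ∷ q) = ∣p∪q∣≤∣p∣+∣q∣ p q
∣p∪q∣≤∣p∣+∣q∣ (outside ∷ p) (inside  ∷ q) =
  ℕ.≤-trans (s≤s (∣p∪q∣≤∣p∣+∣q∣ p q)) (ℕ.≤-reflexive (sym (ℕ.+-suc _ _)))
∣p∪q∣≤∣p∣+∣q∣ (inside  ∷ p) (s       ∷ q) =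
  s≤s (ℕ.≤-trans (∣p∪q∣≤∣p∣+∣q∣ p q) (ℕ.+-monoʳ-≤ ∣ p ∣ (∣p∣≤∣x∷p∣ s q)))

∣⁅x⁆∪⁅y⁆∣≤2 : ∀ (x y : Fin n) → ∣ ⁅ x ⁆ ∪ ⁅ y ⁆ ∣ ≤ 2
∣⁅x⁆∪⁅y⁆∣≤2 x y = ℕ.≤-trans (∣p∪q∣≤∣p∣+∣q∣ ⁅ x ⁆ ⁅ y ⁆) (ℕ.≤-reflexive (cong₂ _+_ (∣⁅x⁆∣≡1 x) (∣⁅x⁆∣≡1 y)))

x∈⁅y⁆∪⁅z⁆⇒ : x ∈ ⁅ y ⁆ ∪ ⁅ z ⁆ → x ≡ y ⊎ x ≡ z
x∈⁅y⁆∪⁅z⁆⇒ {y = y} {z} = Sum.map (x∈⁅y⁆⇒x≡y y) (x∈⁅y⁆⇒x≡y z) ∘ x∈p∪q⁻ ⁅ y ⁆ ⁅ z ⁆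

⁅⁆-injective : ⁅ x ⁆ ≡ ⁅ y ⁆ → x ≡ y
⁅⁆-injective {x = x} {y} eq = x∈⁅y⁆⇒x≡y y (subst (x ∈_) eq (x∈⁅x⁆ x))

x∈p─q⇒x∉q : x ∈ p ─ q → x ∉ q
x∈p─q⇒x∉q {p = _ ∷ _} {q = outside ∷ _} here          ()
x∈p─q⇒x∉q {p = _ ∷ _} {q = _       ∷ _} (there x∈p─q) (there x∈q) = x∈p─q⇒x∉q x∈p─q x∈q

x∈p-y⇒x≢y : x ∈ p - y → x ≢ y
x∈p-y⇒x≢y {y = y} x∈p-y refl = x∈p─q⇒x∉q x∈p-y (x∈⁅x⁆ y)

x∈p⇒0<∣p∣ : x ∈ p → 0 < ∣ p ∣
x∈p⇒0<∣p∣               here        = s≤s z≤n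
x∈p⇒0<∣p∣ {p = s ∷ p} (there x∈p) = ℕ.≤-trans (x∈p⇒0<∣p∣ x∈p) (∣p∣≤∣x∷p∣ s p)

0<∣p∣⇒nonempty : ∀ (p : Subset n) → 0 < ∣ p ∣ → Nonempty p
0<∣p∣⇒nonempty (inside  ∷ p) _     = zero , here
0<∣p∣⇒nonempty (outside ∷ p) 0<∣p∣ = Product.map suc there (0<∣p∣⇒nonempty p 0<∣p∣)

∣p∣≤1+∣p-x∣ : ∀ (p : Subset n) x → ∣ p ∣ ≤ suc ∣ p - x ∣
∣p∣≤1+∣p-x∣ p x = begin
  ∣ p ∣                       ≡⟨ ∣p∣≡∣p∩q∣+∣p─q∣ p ⁅ x ⁆ ⟩
  ∣ p ∩ ⁅ x ⁆ ∣ + ∣ p - x ∣  ≤⟨ ℕ.+-monoˡ-≤ _ (∣p∩q∣≤∣q∣ p ⁅ x ⁆) ⟩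
  ∣ ⁅ x ⁆ ∣ + ∣ p - x ∣      ≡⟨ cong (_+ ∣ p - x ∣) (∣⁅x⁆∣≡1 x) ⟩
  suc ∣ p - x ∣               ∎
  where open ℕ.≤-Reasoning

x∈p∧y∈p∧x≢y⇒2≤∣p∣ : x ∈ p → y ∈ p → x ≢ y → 2 ≤ ∣ p ∣
x∈p∧y∈p∧x≢y⇒2≤∣p∣ x∈p y∈p x≢y =
  ℕ.≤-trans (s≤s (x∈p⇒0<∣p∣ (x∈p∧x≢y⇒x∈p-y y∈p (x≢y ∘ sym)))) (x∈p⇒∣p-x∣<∣p∣ x∈p)

2≤∣p∣⇒∃≢ : ∀ (p : Subset n) → 2 ≤ ∣ p ∣ → ∀ x → ∃ λ y → y ∈ p × y ≢ x
2≤∣p∣⇒∃≢ p 2≤∣p∣ x =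
  let y , y∈p-x = 0<∣p∣⇒nonempty (p - x) (ℕ.≤-pred (ℕ.≤-trans 2≤∣p∣ (∣p∣≤1+∣p-x∣ p x)))
  in y , p─q⊆p p ⁅ x ⁆ y∈p-x , x∈p-y⇒x≢y y∈p-x

3≤∣p∣⇒∃≢₂ : ∀ (p : Subset n) → 3 ≤ ∣ p ∣ → ∀ x y → ∃ λ z → z ∈ p × z ≢ x × z ≢ y
3≤∣p∣⇒∃≢₂ p 3≤∣p∣ x y =
  let z , z∈p-x , z≢y = 2≤∣p∣⇒∃≢ (p - x) (ℕ.≤-pred (ℕ.≤-trans 3≤∣p∣ (∣p∣≤1+∣p-x∣ p x))) y
  in z , p─q⊆p p ⁅ x ⁆ z∈p-x , x∈p-y⇒x≢y z∈p-x , z≢y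

3≤n⇒∃≢₂ : 3 ≤ n → ∀ (x y : Fin n) → ∃ λ z → z ≢ x × z ≢ y
3≤n⇒∃≢₂ {n} 3≤n x y = Product.map₂ proj₂ (3≤∣p∣⇒∃≢₂ ⊤ (subst (3 ≤_) (sym (∣⊤∣≡n n)) 3≤n) x y)

subsetsOf : Subset n → List (Subset n)
subsetsOf []            = [] ∷ []
subsetsOf (outside ∷ p) = map (outside ∷_) (subsetsOf p)
subsetsOf (inside  ∷ p) = map (outside ∷_) (subsetsOf p) ++ map (inside ∷_) (subsetsOf p)

length-subsetsOf : ∀ (p : Subset n) → length (subsetsOf p) ≡ 2 ^ ∣ p ∣
length-subsetsOf []            = refl
length-subsetsOf (outside ∷ p) = trans (length-map _ (subsetsOf p)) (length-subsetsOf p)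
length-subsetsOf (inside  ∷ p) = begin
  length (map (outside ∷_) (subsetsOf p) ++ map (inside ∷_) (subsetsOf p))
    ≡⟨ length-++ (map (outside ∷_) (subsetsOf p)) ⟩
  length (map (outside ∷_) (subsetsOf p)) + length (map (inside ∷_) (subsetsOf p))
    ≡⟨ cong₂ _+_ (length-map _ (subsetsOf p)) (length-map _ (subsetsOf p)) ⟩
  length (subsetsOf p) + length (subsetsOf p)
    ≡⟨ cong₂ _+_ (length-subsetsOf p) (trans (length-subsetsOf p) (sym (ℕ.+-identityʳ _))) ⟩
  2 ^ suc ∣ p ∣ ∎
  where open ≡-Reasoning

subsetsOf-unique : ∀ (p : Subset n) → Unique (subsetsOf p)
subsetsOf-unique []            = [] ∷ []
subsetsOf-unique (outside ∷ p) = Unique.map⁺ ∷-injectiveʳ (subsetsOf-unique p)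
subsetsOf-unique (inside  ∷ p) = Unique.++⁺
  (Unique.map⁺ ∷-injectiveʳ (subsetsOf-unique p))
  (Unique.map⁺ ∷-injectiveʳ (subsetsOf-unique p))
  heads-differ
  where
  heads-differ : Disjoint (map (outside ∷_) (subsetsOf p)) (map (inside ∷_) (subsetsOf p))
  heads-differ (r∈outside , r∈inside) with ∈-map⁻ _ r∈outside | ∈-map⁻ _ r∈inside
  ... | _ , _ , refl | _ , _ , ()

subsetsOf-⊆ : ∀ (p : Subset n) → All (_⊆ p) (subsetsOf p)
subsetsOf-⊆ []            = (λ ()) ∷ []
subsetsOf-⊆ (outside ∷ p) = All.map⁺ (All.map out⊆ (subsetsOf-⊆ p))
subsetsOf-⊆ (inside  ∷ p) = All.++⁺ (All.map⁺ (All.map out⊆ (subsetsOf-⊆ p)))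
                                    (All.map⁺ (All.map s⊆s (subsetsOf-⊆ p)))

elements : Subset n → List (Fin n)
elements []            = []
elements (outside ∷ p) = map suc (elements p)
elements (inside  ∷ p) = zero ∷ map suc (elements p)

length-elements : ∀ (p : Subset n) → length (elements p) ≡ ∣ p ∣
length-elements []            = refl
length-elements (outside ∷ p) = trans (length-map suc (elements p)) (length-elements p)
length-elements (inside  ∷ p) = cong suc (trans (length-map suc (elements p)) (length-elements p))

elements-unique : ∀ (p : Subset n) → Unique (elements p)
elements-unique []            = []
elements-unique (outside ∷ p) = Unique.map⁺ Fin.suc-injective (elements-unique p)
elements-unique (inside  ∷ p) =
  All.map⁺ (All.tabulate λ _ ()) ∷ Unique.map⁺ Fin.suc-injective (elements-unique p)

elements-∈ : ∀ (p : Subset n) → All (_∈ p) (elements p)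
elements-∈ []            = []
elements-∈ (outside ∷ p) = All.map⁺ (All.map there (elements-∈ p))
elements-∈ (inside  ∷ p) = here ∷ All.map⁺ (All.map there (elements-∈ p))

lookup-injective : ∀ {xs : List A} → Unique xs → ∀ {i j} → List.lookup xs i ≡ List.lookup xs j → i ≡ j
lookup-injective (_  ∷ _) {zero}  {zero}  _ = refl
lookup-injective (x≢ ∷ _) {zero}  {suc j} e = contradiction e (All.lookup x≢ (∈-lookup j))
lookup-injective (x≢ ∷ _) {suc i} {zero}  e = contradiction (sym e) (All.lookup x≢ (∈-lookup i))
lookup-injective (_  ∷ u) {suc i} {suc j} e = cong suc (lookup-injective u e)

map-unique-on : ∀ {P : Pred A ℓ} {f : A → B} → (∀ {x y} → P x → P y → f x ≡ f y → x ≡ y) →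
                ∀ {xs} → All P xs → Unique xs → Unique (map f xs)
map-unique-on inj []         []       = []
map-unique-on inj (px ∷ pxs) (x≢ ∷ u) =
  All.map⁺ (All.zipWith (λ (py , x≢y) → x≢y ∘ inj px py) (pxs , x≢)) ∷ map-unique-on inj pxs u

disjoint-by : ∀ {P : Pred A ℓ} {xs ys} → All P xs → All (¬_ ∘ P) ys → Disjoint xs ys
disjoint-by pxs ¬pys (r∈xs , r∈ys) = All.lookup ¬pys r∈ys (All.lookup pxs r∈xs)

length-cartesianProduct : ∀ (xs : List A) (ys : List B) →
                          length (List.cartesianProduct xs ys) ≡ length xs * length ys
length-cartesianProduct []       ys = refl
length-cartesianProduct (x ∷ xs) ys = begin
  length (map (x ,_) ys ++ List.cartesianProduct xs ys)
    ≡⟨ length-++ (map (x ,_) ys) ⟩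
  length (map (x ,_) ys) + length (List.cartesianProduct xs ys)
    ≡⟨ cong₂ _+_ (length-map _ ys) (length-cartesianProduct xs ys) ⟩
  length ys + length xs * length ys ∎
  where open ≡-Reasoning

pairs : List A → (A → List B) → List (A × B)
pairs []       f = []
pairs (x ∷ xs) f = map (x ,_) (f x) ++ pairs xs f

∈-pairs⁻ : ∀ (xs : List A) {f : A → List B} {r} → r List.∈ pairs xs f →
           proj₁ r List.∈ xs × proj₂ r List.∈ f (proj₁ r)
∈-pairs⁻ (x ∷ xs) r∈ with ∈-++⁻ (map (x ,_) _) r∈
... | inj₂ r∈rest = Product.map₁ Any.there (∈-pairs⁻ xs r∈rest)
... | inj₁ r∈x×f with ∈-map⁻ (x ,_) r∈x×f
...   | _ , y∈ , refl = Any.here refl , y∈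

pairs-unique : ∀ {xs : List A} {f : A → List B} → Unique xs → (∀ x → Unique (f x)) → Unique (pairs xs f)
pairs-unique {xs = []}     _        _  = []
pairs-unique {xs = x ∷ xs} (x≢ ∷ u) uf =
  Unique.++⁺ (Unique.map⁺ (cong proj₂) (uf x)) (pairs-unique u uf) λ (r∈x×f , r∈rest) →
    case ∈-map⁻ (x ,_) r∈x×f of λ where
      (_ , _ , refl) → All.lookup x≢ (proj₁ (∈-pairs⁻ xs r∈rest)) refl

length-pairs-∷ : ∀ (x : A) xs (f : A → List B) →
                 length (pairs (x ∷ xs) f) ≡ length (f x) + length (pairs xs f)
length-pairs-∷ x xs f = trans (length-++ (map (x ,_) (f x))) (cong (_+ _) (length-map _ (f x)))

private variable
  R R′ : Fin n → Fin n → Set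

_++ʷ_ : Walk R x y → Walk R y z → Walk R x z
here     ++ʷ w′ = w′
step r w ++ʷ w′ = step r (w ++ʷ w′)

mapʷ : (∀ {a b} → R a b → R′ a b) → Walk R x y → Walk R′ x y
mapʷ f here       = here
mapʷ f (step r w) = step (f r) (mapʷ f w)

first-step : Walk R x y → x ≢ y → ∃ (R x)
first-step here       x≢x = contradiction refl x≢x
first-step (step r _) _   = _ , r

-- Floyd–Warshall: a walk whose interior vertices lie in z ∷ zs either avoids z or splits at z.
module Reachability {R : Fin n → Fin n → Set} (R? : ∀ x y → Dec (R x y)) where

  data WalkVia (zs : List (Fin n)) : Fin n → Fin n → Set where
    []     : WalkVia zs x x
    [_]    : R x y → WalkVia zs x y
    _∷⟨_⟩_ : R x y → y List.∈ zs → WalkVia zs y z → WalkVia zs x z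

  Via : List (Fin n) → Fin n → Fin n → Set
  Via []       x y = x ≡ y ⊎ R x y
  Via (z ∷ zs) x y = Via zs x y ⊎ (Via zs x z × Via zs z y)

  via? : ∀ zs x y → Dec (Via zs x y)
  via? []       x y = (x Fin.≟ y) ⊎-dec R? x y
  via? (z ∷ zs) x y = via? zs x y ⊎-dec (via? zs x z ×-dec via? zs z y)

  via⇒walk : ∀ zs → Via zs x y → Walk R x y
  via⇒walk []       (inj₁ refl)      = here
  via⇒walk []       (inj₂ r)         = step r here
  via⇒walk (z ∷ zs) (inj₁ v)         = via⇒walk zs v
  via⇒walk (z ∷ zs) (inj₂ (v₁ , v₂)) = via⇒walk zs v₁ ++ʷ via⇒walk zs v₂

  split : ∀ {zs} → WalkVia (z ∷ zs) x y → WalkVia zs x y ⊎ (WalkVia zs x z × WalkVia zs z y)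
  split []                       = inj₁ []
  split [ r ]                    = inj₁ [ r ]
  split (r ∷⟨ Any.here refl ⟩ w) with split w
  ... | inj₁ w′       = inj₂ ([ r ] , w′)
  ... | inj₂ (_ , w′) = inj₂ ([ r ] , w′)
  split (r ∷⟨ Any.there y∈ ⟩ w) with split w
  ... | inj₁ w′        = inj₁ (r ∷⟨ y∈ ⟩ w′)
  ... | inj₂ (w₁ , w₂) = inj₂ (r ∷⟨ y∈ ⟩ w₁ , w₂)

  walkVia⇒via : ∀ zs → WalkVia zs x y → Via zs x y
  walkVia⇒via []       []    = inj₁ refl
  walkVia⇒via []       [ r ] = inj₂ r
  walkVia⇒via (z ∷ zs) w with split w
  ... | inj₁ w′        = inj₁ (walkVia⇒via zs w′)
  ... | inj₂ (w₁ , w₂) = inj₂ (walkVia⇒via zs w₁ , walkVia⇒via zs w₂)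

  walk⇒walkVia : Walk R x y → WalkVia (List.allFin n) x y
  walk⇒walkVia here                 = []
  walk⇒walkVia (step r here)        = [ r ]
  walk⇒walkVia (step r (step r′ w)) = r ∷⟨ ∈-allFin _ ⟩ walk⇒walkVia (step r′ w)

  walk? : ∀ x y → Dec (Walk R x y)
  walk? x y = Dec.map′ (via⇒walk (List.allFin n)) (walkVia⇒via (List.allFin n) ∘ walk⇒walkVia)
                       (via? (List.allFin n) x y)

module _ {R : Fin n → Fin n → Set} (R-sym : ∀ {x y} → R x y → R y x)
         {S : Fin n → Set} (S? : Decidable S)
         (pendant : ∀ {s y y′} → S s → R s y → R s y′ → y ≡ y′) where

  -- A walk entering a pendant vertex must leave it back along the same edge.
  avoid-pendants : Walk R x y → ¬ S x → ¬ S y → Walk (λ a b → ¬ S a × ¬ S b × R a b) x y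
  avoid-pendants here _ _ = here
  avoid-pendants (step {y = y} r w) ¬Sx ¬Sz with S? y | w
  ... | no ¬Sy | _          = step (¬Sx , ¬Sy , r) (avoid-pendants w ¬Sy ¬Sz)
  ... | yes Sy | here       = contradiction Sy ¬Sz
  ... | yes Sy | step r′ w′ with refl ← pendant Sy r′ (R-sym r) = avoid-pendants w′ ¬Sx ¬Sz

-- Leaves, cut vertices and blocks

module _ (G : Graph n) where

  Adj-sym : Adj G x y → Adj G y x
  Adj-sym {x} {y} = subst T (Graph.sym G x y)

  Adj-irrefl : Adj G x y → x ≢ y
  Adj-irrefl {x} x~x refl = subst T (Graph.irr G x) x~x

  Adj? : ∀ x y → Dec (Adj G x y)
  Adj? x y = T? (adj G x y)

  neighbours : Fin n → Subset n
  neighbours w = ⟦ Adj? w ⟧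

  degree : Fin n → ℕ
  degree w = ∣ neighbours w ∣

  IsLeaf : Fin n → Set
  IsLeaf w = degree w ≤ 1

  leaves : Subset n
  leaves = ⟦ (λ w → degree w ℕ.≤? 1) ⟧

  ∈leaves⁺ : IsLeaf w → w ∈ leaves
  ∈leaves⁺ = ∈⟦⟧⁺ (λ w → degree w ℕ.≤? 1)

  ∈leaves⁻ : w ∈ leaves → IsLeaf w
  ∈leaves⁻ = ∈⟦⟧⁻ (λ w → degree w ℕ.≤? 1)

  two-neighbours⇒¬leaf : Adj G w x → Adj G w y → x ≢ y → ¬ IsLeaf w
  two-neighbours⇒¬leaf w~x w~y x≢y =
    ℕ.<⇒≱ (x∈p∧y∈p∧x≢y⇒2≤∣p∣ (∈⟦⟧⁺ (Adj? _) w~x) (∈⟦⟧⁺ (Adj? _) w~y) x≢y)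

  leaf-neighbour-unique : IsLeaf w → Adj G w y → Adj G w z → y ≡ z
  leaf-neighbour-unique w-leaf w~y w~z =
    Dec.decidable-stable (_ Fin.≟ _) (λ y≢z → two-neighbours⇒¬leaf w~y w~z y≢z w-leaf)

  ¬leaf⇒other-neighbour : ¬ IsLeaf w → ∀ x → ∃ λ y → Adj G w y × y ≢ x
  ¬leaf⇒other-neighbour {w} ¬leaf x =
    let y , y∈ , y≢x = 2≤∣p∣⇒∃≢ (neighbours w) (ℕ.≰⇒> ¬leaf) x in y , ∈⟦⟧⁻ (Adj? w) y∈ , y≢x

  AdjAvoiding : Fin n → Fin n → Fin n → Set
  AdjAvoiding w a b = a ≢ w × b ≢ w × Adj G a b

  noncut⇒walk-avoiding : ¬ IsCutVertex G w → x ≢ w → y ≢ w → Walk (AdjAvoiding w) x y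
  noncut⇒walk-avoiding {w} {x} {y} ¬cut x≢w y≢w =
    Dec.decidable-stable (Reachability.walk? avoiding? x y) (λ ¬walk → ¬cut (x , y , x≢w , y≢w , ¬walk))
    where
    avoiding? : ∀ a b → Dec (AdjAvoiding w a b)
    avoiding? a b = Dec.¬? (a Fin.≟ w) ×-dec Dec.¬? (b Fin.≟ w) ×-dec Adj? a b

  noncut-neighbour-¬leaf : 3 ≤ n → ¬ IsCutVertex G w → Adj G w x → ¬ IsLeaf x
  noncut-neighbour-¬leaf {w} {x} 3≤n ¬cut w~x =
    let z , z≢w , z≢x     = 3≤n⇒∃≢₂ 3≤n w x
        y , _ , y≢w , x~y = first-step (noncut⇒walk-avoiding ¬cut (Adj-irrefl w~x ∘ sym) z≢w) (z≢x ∘ sym)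
    in two-neighbours⇒¬leaf (Adj-sym w~x) x~y (y≢w ∘ sym)

  leaf-neighbour-cut : 3 ≤ n → IsLeaf u → Adj G u v → IsCutVertex G v
  leaf-neighbour-cut {u} {v} 3≤n u-leaf u~v =
    let z , z≢u , z≢v = 3≤n⇒∃≢₂ 3≤n u v
    in u , z , Adj-irrefl u~v , z≢v , λ walk →
         let y , _ , y≢v , u~y = first-step walk (z≢u ∘ sym)
         in y≢v (leaf-neighbour-unique u-leaf u~y u~v)

  block-leaf-adjacent : ∀ {B} → IsBlock G B → u ∈ verts B → v ∈ verts B → u ≢ v → IsLeaf u → Adj G u v
  block-leaf-adjacent (inj₂ (x , y , (x~y , _) , B-verts , _)) u∈B v∈B u≢v _
    with proj₁ (B-verts _) u∈B | proj₁ (B-verts _) v∈B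
  ... | inj₁ refl | inj₁ refl = contradiction refl u≢v
  ... | inj₁ refl | inj₂ refl = x~y
  ... | inj₂ refl | inj₁ refl = Adj-sym x~y
  ... | inj₂ refl | inj₂ refl = contradiction refl u≢v
  block-leaf-adjacent {u} {v} {B} (inj₁ (B⊆G , (3≤∣B∣ , (_ , B-conn) , B-2conn) , _)) u∈B v∈B u≢v u-leaf =
    let x , u-x              = first-step (B-conn u v u∈B v∈B) u≢v
        u~x , _ , _ , x∈B    = B⊆G u x u-x
        z , z∈B , z≢u , z≢x  = 3≤∣p∣⇒∃≢₂ (verts B) 3≤∣B∣ u x
        y , (u-y , _ , y≢x)  = first-step (B-2conn x x∈B u z u∈B z∈B (Adj-irrefl u~x) z≢x) (z≢u ∘ sym)
        u~y , _              = B⊆G u y u-y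
    in contradiction u-leaf (two-neighbours⇒¬leaf u~x u~y (y≢x ∘ sym))

  leaves-around⇒star : ConnectedGraph G → 3 ≤ n → ∀ c → (∀ {z} → z ≢ c → ¬ IsCutVertex G z × IsLeaf z) →
                       (∀ x → x ≢ c → Adj G x c) × (∀ x y → Adj G x y → x ≡ c ⊎ y ≡ c)
  leaves-around⇒star conn 3≤n c around = spokes , through-c
    where
    spokes : ∀ x → x ≢ c → Adj G x c
    spokes x x≢c =
      let y , x~y = first-step (conn x c) x≢c
          ¬leaf-y = noncut-neighbour-¬leaf 3≤n (proj₁ (around x≢c)) x~y
      in subst (Adj G x) (Dec.decidable-stable (y Fin.≟ c) (¬leaf-y ∘ proj₂ ∘ around)) x~y

    through-c : ∀ x y → Adj G x y → x ≡ c ⊎ y ≡ c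
    through-c x y x~y with x Fin.≟ c
    ... | yes x≡c = inj₁ x≡c
    ... | no  x≢c = inj₂ (leaf-neighbour-unique (proj₂ (around x≢c)) x~y (spokes x x≢c))

-- The subgraphs G - S - ε

Joins : Fin n × Fin n → Fin n → Fin n → Set
Joins (w , x) a b = (a ≡ w × b ≡ x) ⊎ (a ≡ x × b ≡ w)

Joins? : ∀ (e : Fin n × Fin n) a b → Dec (Joins e a b)
Joins? (w , x) a b = (a Fin.≟ w ×-dec b Fin.≟ x) ⊎-dec (a Fin.≟ x ×-dec b Fin.≟ w)

Keeps : Maybe (Fin n × Fin n) → Fin n → Fin n → Set
Keeps nothing  a b = Unit
Keeps (just e) a b = ¬ Joins e a b

Keeps? : ∀ (ε : Maybe (Fin n × Fin n)) a b → Dec (Keeps ε a b)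
Keeps? nothing  a b = yes tt
Keeps? (just e) a b = Dec.¬? (Joins? e a b)

Keeps-sym : ∀ ε → Keeps ε x y → Keeps ε y x
Keeps-sym nothing  _      = tt
Keeps-sym (just e) ¬joins = ¬joins ∘ Sum.swap ∘ Sum.map Product.swap Product.swap

Keeps-swap : ∀ (e : Fin n × Fin n) → Keeps (just e) x y → Keeps (just (Product.swap e)) x y
Keeps-swap e ¬joins = ¬joins ∘ Sum.swap

module _ (G : Graph n) where

  Kept : Maybe (Fin n × Fin n) → Fin n → Fin n → Set
  Kept ε a b = Adj G a b × Keeps ε a b

  Kept-sym : ∀ ε → Kept ε x y → Kept ε y x
  Kept-sym ε = Product.map (Adj-sym G) (Keeps-sym ε)

  Remains : Subset n → Maybe (Fin n × Fin n) → Fin n → Fin n → Set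
  Remains S ε a b = a ∉ S × b ∉ S × Kept ε a b

  Remains? : ∀ S ε a b → Dec (Remains S ε a b)
  Remains? S ε a b = Dec.¬? (a ∈? S) ×-dec Dec.¬? (b ∈? S) ×-dec Adj? G a b ×-dec Keeps? ε a b

  pruned : Subset n → Maybe (Fin n × Fin n) → Sub n
  pruned S ε = sub (∁ S) (tabulate λ a → ⟦ Remains? S ε a ⟧)

  Edge-pruned⁺ : ∀ {S ε} → Remains S ε x y → Edge (pruned S ε) x y
  Edge-pruned⁺ {x} {S = S} {ε} xy = subst (_ ∈_) (sym (lookup∘tabulate _ x)) (∈⟦⟧⁺ (Remains? S ε x) xy)

  Edge-pruned⁻ : ∀ {S ε} → Edge (pruned S ε) x y → Remains S ε x y
  Edge-pruned⁻ {x} {S = S} {ε} xy = ∈⟦⟧⁻ (Remains? S ε x) (subst (_ ∈_) (lookup∘tabulate _ x) xy)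

  ConnSubThrough : Fin n → Fin n → Sub n → Set
  ConnSubThrough u v H = IsSubgraph G H × ConnectedSub H × u ∈ verts H × v ∈ verts H

  pruned-through : ∀ {S} ε → u ∉ S → v ∉ S → (∀ {a b} → a ∉ S → b ∉ S → Walk (Remains S ε) a b) →
                   ConnSubThrough u v (pruned S ε)
  pruned-through {u} ε u∉S v∉S walks =
    (λ a b ab → let a∉S , b∉S , kept = Edge-pruned⁻ ab
                in proj₁ kept , Edge-pruned⁺ (b∉S , a∉S , Kept-sym ε kept) , x∉p⇒x∈∁p a∉S , x∉p⇒x∈∁p b∉S) ,
    ((u , x∉p⇒x∈∁p u∉S) , λ a b a∈ b∈ → mapʷ Edge-pruned⁺ (walks (x∈∁p⇒x∉p a∈) (x∈∁p⇒x∉p b∈))) ,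
    x∉p⇒x∈∁p u∉S , x∉p⇒x∈∁p v∉S

  leaves-pruned-through : ∀ {S} ε → (∀ {s} → s ∈ S → IsLeaf G s) → u ∉ S → v ∉ S →
                          (∀ a b → Walk (Kept ε) a b) → ConnSubThrough u v (pruned S ε)
  leaves-pruned-through {S = S} ε S-leaves u∉S v∉S walks =
    pruned-through ε u∉S v∉S λ a∉S b∉S →
      avoid-pendants (Kept-sym ε) (_∈? S)
        (λ s∈S s~y s~z → leaf-neighbour-unique G (S-leaves s∈S) (proj₁ s~y) (proj₁ s~z))
        (walks _ _) a∉S b∉S

  deletion-through : ¬ IsCutVertex G w → u ≢ w → v ≢ w → ConnSubThrough u v (pruned ⁅ w ⁆ nothing)
  deletion-through ¬cut u≢w v≢w =
    pruned-through nothing (x≢y⇒x∉⁅y⁆ u≢w) (x≢y⇒x∉⁅y⁆ v≢w) λ a∉ b∉ →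
      mapʷ (λ (p≢w , q≢w , p~q) → x≢y⇒x∉⁅y⁆ p≢w , x≢y⇒x∉⁅y⁆ q≢w , p~q , tt)
           (noncut⇒walk-avoiding G ¬cut (x∉⁅y⁆⇒x≢y a∉) (x∉⁅y⁆⇒x≢y b∉))

  pair-through : u ≡ v ⊎ Adj G u v → ConnSubThrough u v (pruned (∁ (⁅ u ⁆ ∪ ⁅ v ⁆)) nothing)
  pair-through {u} {v} u≈v =
    pruned-through nothing (x∈p⇒x∉∁p (x∈p∪q⁺ (inj₁ (x∈⁅x⁆ u)))) (x∈p⇒x∉∁p (x∈p∪q⁺ (inj₂ (x∈⁅x⁆ v))))
      λ {a} {b} a∉ b∉ → case a Fin.≟ b of λ where
        (yes refl) → here
        (no a≢b)   → step (a∉ , b∉ , adjacent (ends a∉) (ends b∉) a≢b , tt) here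
    where
    ends : x ∉ ∁ (⁅ u ⁆ ∪ ⁅ v ⁆) → x ≡ u ⊎ x ≡ v
    ends = x∈⁅y⁆∪⁅z⁆⇒ ∘ x∉∁p⇒x∈p
    adjacent : x ≡ u ⊎ x ≡ v → y ≡ u ⊎ y ≡ v → x ≢ y → Adj G x y
    adjacent (inj₁ refl) (inj₁ refl) x≢y = contradiction refl x≢y
    adjacent (inj₂ refl) (inj₂ refl) x≢y = contradiction refl x≢y
    adjacent (inj₁ refl) (inj₂ refl) x≢y = Sum.[ flip contradiction x≢y , id ] u≈v
    adjacent (inj₂ refl) (inj₁ refl) x≢y = Sum.[ flip contradiction (x≢y ∘ sym) , Adj-sym G ] u≈v

  -- Listing the deleted edge with its smaller end first makes the pair (S , ε) recoverable.
  VisibleIn : Subset n → Maybe (Fin n × Fin n) → Set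
  VisibleIn S nothing        = Unit
  VisibleIn S (just (w , x)) = w ∉ S × x ∉ S × Adj G w x × w Fin.< x

  private
    removed-edge : ∀ {S} e → ¬ Edge (pruned S (just e)) (proj₁ e) (proj₂ e)
    removed-edge {S} e wx = proj₂ (proj₂ (proj₂ (Edge-pruned⁻ {S = S} {just e} wx))) (inj₁ (refl , refl))

    same-vertices-same-edge : ∀ {S} ε ε′ → VisibleIn S ε → VisibleIn S ε′ → pruned S ε ≡ pruned S ε′ → ε ≡ ε′
    same-vertices-same-edge nothing  nothing  _ _ _ = refl
    same-vertices-same-edge nothing  (just e) _ (w∉ , x∉ , w~x , _) eq =
      ⊥-elim (removed-edge e (subst (λ H → Edge H _ _) eq (Edge-pruned⁺ (w∉ , x∉ , w~x , tt))))
    same-vertices-same-edge (just e) nothing  (w∉ , x∉ , w~x , _) _ eq =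
      ⊥-elim (removed-edge e (subst (λ H → Edge H _ _) (sym eq) (Edge-pruned⁺ (w∉ , x∉ , w~x , tt))))
    -- The edge e′ is missing from G - S - e′, hence from G - S - e, so e joins the ends of e′.
    same-vertices-same-edge (just (w , x)) (just (w′ , x′)) (_ , _ , _ , w<x) (w′∉ , x′∉ , w′~x′ , w′<x′) eq
      with Dec.decidable-stable (Joins? (w , x) w′ x′) (λ ¬joins →
             removed-edge (w′ , x′) (subst (λ H → Edge H _ _) eq (Edge-pruned⁺ (w′∉ , x′∉ , w′~x′ , ¬joins))))
    ... | inj₁ (refl , refl) = refl
    ... | inj₂ (refl , refl) = contradiction w<x (Fin.<-asym w′<x′)

  pruned-injective : ∀ {S S′ ε ε′} → VisibleIn S ε → VisibleIn S′ ε′ → pruned S ε ≡ pruned S′ ε′ →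
                     (S , ε) ≡ (S′ , ε′)
  pruned-injective {S} {S′} {ε} {ε′} vis vis′ eq with ⊆-antisym
    (∁p⊆∁q⇒p⊇q (⊆-reflexive (sym (cong verts eq)))) (∁p⊆∁q⇒p⊇q (⊆-reflexive (cong verts eq)))
  ... | refl = cong (S ,_) (same-vertices-same-edge ε ε′ vis vis′ eq)

  private
    kept-avoiding : ¬ IsCutVertex G w → ∀ x {p q} → p ≢ w → q ≢ w → Walk (Kept (just (w , x))) p q
    kept-avoiding ¬cut x p≢w q≢w = mapʷ (λ (p≢w , q≢w , p~q) → p~q , Sum.[ p≢w ∘ proj₁ , q≢w ∘ proj₂ ])
                                        (noncut⇒walk-avoiding G ¬cut p≢w q≢w)

    kept-other : Adj G w y → y ≢ x → Kept (just (w , x)) w y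
    kept-other w~y y≢x = w~y , Sum.[ y≢x ∘ proj₂ , Adj-irrefl G w~y ∘ sym ∘ proj₂ ]

  edge-deletion-connected : ¬ IsCutVertex G w → ¬ IsLeaf G w → ∀ x a b → Walk (Kept (just (w , x))) a b
  edge-deletion-connected {w} ¬cut ¬leaf x a b with ¬leaf⇒other-neighbour G ¬leaf x | a Fin.≟ w | b Fin.≟ w
  ... | _             | yes refl | yes refl = here
  ... | y , w~y , y≢x | yes refl | no b≢w   =
    step (kept-other w~y y≢x) (kept-avoiding ¬cut x (Adj-irrefl G w~y ∘ sym) b≢w)
  ... | y , w~y , y≢x | no a≢w   | yes refl =
    kept-avoiding ¬cut x a≢w (Adj-irrefl G w~y ∘ sym) ++ʷ step (Kept-sym (just _) (kept-other w~y y≢x)) here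
  ... | _             | no a≢w   | no b≢w   = kept-avoiding ¬cut x a≢w b≢w

  EdgeMeeting : Subset n → Fin n × Fin n → Set
  EdgeMeeting M (a , b) = Adj G a b × a Fin.< b × (a ∈ M ⊎ b ∈ M)

  private
    above : Fin n → Subset n
    above w = ⟦ (w Fin.<?_) ⟧

    upper lower : Fin n → List (Fin n)
    upper w = elements (neighbours G w ∩ above w)
    lower w = elements (neighbours G w ─ above w)

    length-upper+lower : ∀ w → length (upper w) + length (lower w) ≡ degree G w
    length-upper+lower w = trans (cong₂ _+_ (length-elements (neighbours G w ∩ above w))
                                            (length-elements (neighbours G w ─ above w)))
                                 (sym (∣p∣≡∣p∩q∣+∣p─q∣ (neighbours G w) (above w)))

    double-count : ∀ ws → All (¬_ ∘ IsLeaf G) ws →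
                   length ws + length ws ≤ length (pairs ws upper) + length (pairs ws lower)
    double-count []       []                = z≤n
    double-count (w ∷ ws) (¬leaf ∷ ¬leaves) = begin
      suc (length ws) + suc (length ws)       ≡⟨ cong suc (ℕ.+-suc _ _) ⟩
      2 + (length ws + length ws)             ≤⟨ ℕ.+-mono-≤ (ℕ.≰⇒> ¬leaf) (double-count ws ¬leaves) ⟩
      degree G w + (length ↑ws + length ↓ws)
        ≡⟨ cong (_+ (length ↑ws + length ↓ws)) (sym (length-upper+lower w)) ⟩
      (length (upper w) + length (lower w)) + (length ↑ws + length ↓ws)
        ≡⟨ +-interchange (length (upper w)) _ _ _ ⟩
      (length (upper w) + length ↑ws) + (length (lower w) + length ↓ws)
        ≡⟨ sym (cong₂ _+_ (length-pairs-∷ w ws upper) (length-pairs-∷ w ws lower)) ⟩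
      length (pairs (w ∷ ws) upper) + length (pairs (w ∷ ws) lower) ∎
      where
      open ℕ.≤-Reasoning
      ↑ws = pairs ws upper
      ↓ws = pairs ws lower

    upward downward : Subset n → List (Fin n × Fin n)
    upward   M = pairs (elements M) upper
    downward M = map Product.swap (pairs (elements M) lower)

    upward-unique : ∀ M → Unique (upward M)
    upward-unique M = pairs-unique (elements-unique M) (λ w → elements-unique (neighbours G w ∩ above w))

    downward-unique : ∀ M → Unique (downward M)
    downward-unique M = Unique.map⁺ (cong Product.swap)
      (pairs-unique (elements-unique M) (λ w → elements-unique (neighbours G w ─ above w)))

    upward-meeting : ∀ M → All (EdgeMeeting M) (upward M)
    upward-meeting M = All.tabulate λ {(w , x)} wx∈ →
      let w∈ , x∈   = ∈-pairs⁻ (elements M) wx∈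
          w~x , w<x = x∈p∩q⁻ _ _ (All.lookup (elements-∈ _) x∈)
      in ∈⟦⟧⁻ (Adj? G w) w~x , ∈⟦⟧⁻ (w Fin.<?_) w<x , inj₁ (All.lookup (elements-∈ M) w∈)

    downward-meeting : ∀ M → All (EdgeMeeting M) (downward M)
    downward-meeting M = All.map⁺ $ All.tabulate λ {(w , x)} wx∈ →
      let w∈ , x∈ = ∈-pairs⁻ (elements M) wx∈
          x∈↓     = All.lookup (elements-∈ _) x∈
          w~x     = ∈⟦⟧⁻ (Adj? G w) (p─q⊆p _ _ x∈↓)
          w≮x     = x∈p─q⇒x∉q x∈↓ ∘ ∈⟦⟧⁺ (w Fin.<?_)
      in Adj-sym G w~x , Fin.≤∧≢⇒< (ℕ.≮⇒≥ w≮x) (Adj-irrefl G w~x ∘ sym) , inj₂ (All.lookup (elements-∈ M) w∈)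

  -- Each edge at M is listed from its lower or from its upper end; as degrees in M are at least 2,
  -- one of the two lists has at least ∣ M ∣ entries.
  edges-meeting : ∀ M → (∀ {w} → w ∈ M → ¬ IsLeaf G w) →
                  Σ (List (Fin n × Fin n)) λ D → Unique D × All (EdgeMeeting M) D × ∣ M ∣ ≤ length D
  edges-meeting M M-inner with ∣ M ∣ ℕ.≤? length (upward M)
  ... | yes M≤↑ = upward M , upward-unique M , upward-meeting M , M≤↑
  ... | no  M≰↑ = downward M , downward-unique M , downward-meeting M , ℕ.+-cancelˡ-≤ ∣ M ∣ _ _ (begin
    ∣ M ∣ + ∣ M ∣                              ≡⟨ sym (cong₂ _+_ (length-elements M) (length-elements M)) ⟩
    length (elements M) + length (elements M)  ≤⟨ double-count (elements M) (All.map M-inner (elements-∈ M)) ⟩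
    length (upward M) + length (pairs (elements M) lower)
      ≤⟨ ℕ.+-mono-≤ (ℕ.<⇒≤ (ℕ.≰⇒> M≰↑))
                    (ℕ.≤-reflexive (sym (length-map Product.swap (pairs (elements M) lower)))) ⟩
    ∣ M ∣ + length (downward M)                ∎)
    where open ℕ.≤-Reasoning

  at-least-length : ∀ {L} → Unique L → All (ConnSubThrough u v) L → ConnSubsThroughAtLeast G u v (length L)
  at-least-length {L = L} uL L-through =
    List.lookup L , (λ _ _ → lookup-injective uL) , λ i → All.lookup L-through (∈-lookup i)

  at-least-≤ : ∀ {m m′} → m ≤ m′ → ConnSubsThroughAtLeast G u v m′ → ConnSubsThroughAtLeast G u v m
  at-least-≤ m≤m′ (F , F-inj , F-through) =
    F ∘ (λ i → Fin.inject≤ i m≤m′) , (λ i j → Fin.inject≤-injective m≤m′ m≤m′ i j ∘ F-inj _ _) , F-through ∘ _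

  at-least-swap : ∀ {m} → ConnSubsThroughAtLeast G u v m → ConnSubsThroughAtLeast G v u m
  at-least-swap (F , F-inj , F-through) =
    F , F-inj , λ i → let H⊆G , H-conn , u∈H , v∈H = F-through i in H⊆G , H-conn , v∈H , u∈H

-- The star K_{1,3}

star⇒K13 : ∀ (G : Graph n) → n ≡ 4 → ∀ (c : Fin n) →
           (∀ x → x ≢ c → Adj G x c) × (∀ x y → Adj G x y → x ≡ c ⊎ y ≡ c) → Iso G K13
star⇒K13 G refl c (spokes , through-c) = τ , λ x y → adjacency x y (x Fin.≟ c) (y Fin.≟ c)
  where
  τ = Perm.transpose c zero

  τc≡0 : τ Perm.⟨$⟩ʳ c ≡ zero
  τc≡0 rewrite dec-true (c Fin.≟ c) refl = refl

  τx≢0 : x ≢ c → τ Perm.⟨$⟩ʳ x ≢ zero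
  τx≢0 {x} x≢c τx≡0 = x≢c (begin
    x                            ≡⟨ Perm.inverseˡ τ ⟨
    τ Perm.⟨$⟩ˡ (τ Perm.⟨$⟩ʳ x)  ≡⟨ cong (τ Perm.⟨$⟩ˡ_) (trans τx≡0 (sym τc≡0)) ⟩
    τ Perm.⟨$⟩ˡ (τ Perm.⟨$⟩ʳ c)  ≡⟨ Perm.inverseˡ τ ⟩
    c                            ∎)
    where open ≡-Reasoning

  adjacency : ∀ x y → Dec (x ≡ c) → Dec (y ≡ c) → adj G x y ≡ starAdj (τ Perm.⟨$⟩ʳ x) (τ Perm.⟨$⟩ʳ y)
  adjacency x y (yes refl) (yes refl) rewrite τc≡0 = Graph.irr G x
  adjacency x y (yes refl) (no y≢c) with τ Perm.⟨$⟩ʳ y | τx≢0 y≢c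
  ... | zero  | τy≢0 = contradiction refl τy≢0
  ... | suc _ | _ rewrite τc≡0 = Equivalence.to T-≡ (Adj-sym G (spokes y y≢c))
  adjacency x y (no x≢c) (yes refl) with τ Perm.⟨$⟩ʳ x | τx≢0 x≢c
  ... | zero  | τx≢0 = contradiction refl τx≢0
  ... | suc _ | _ rewrite τc≡0 = Equivalence.to T-≡ (spokes x x≢c)
  adjacency x y (no x≢c) (no y≢c) with τ Perm.⟨$⟩ʳ x | τx≢0 x≢c | τ Perm.⟨$⟩ʳ y | τx≢0 y≢c
  ... | zero  | τx≢0 | _     | _    = contradiction refl τx≢0
  ... | suc _ | _    | zero  | τy≢0 = contradiction refl τy≢0
  ... | suc _ | _    | suc _ | _    =
    ¬-not λ x~y → Sum.[ x≢c , y≢c ] (through-c x y (Equivalence.from T-≡ x~y))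

-- Arithmetic

2≤2^[1+a] : ∀ a → 2 ≤ 2 ^ suc a
2≤2^[1+a] a = ℕ.*-monoʳ-≤ 2 (ℕ.m^n>0 2 a)

2*a≤2^a : ∀ a → 2 * a ≤ 2 ^ a
2*a≤2^a zero          = z≤n
2*a≤2^a (suc zero)    = ℕ.≤-refl
2*a≤2^a (suc (suc a)) = begin
  2 * suc (suc a)        ≡⟨ ℕ.*-suc 2 (suc a) ⟩
  2 + 2 * suc a          ≤⟨ ℕ.+-mono-≤ (2≤2^[1+a] a) (2*a≤2^a (suc a)) ⟩
  2 ^ suc a + 2 ^ suc a  ≡⟨ cong (2 ^ suc a +_) (sym (ℕ.+-identityʳ _)) ⟩
  2 ^ suc (suc a)        ∎
  where open ℕ.≤-Reasoning

2*[a+t]≤2^a*[1+t] : ∀ a t → 1 ≤ a → 2 * (a + t) ≤ 2 ^ a * suc t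
2*[a+t]≤2^a*[1+t] (suc a) t _ = begin
  2 * (suc a + t)             ≡⟨ ℕ.*-distribˡ-+ 2 (suc a) t ⟩
  2 * suc a + 2 * t           ≤⟨ ℕ.+-mono-≤ (2*a≤2^a (suc a)) (ℕ.*-monoˡ-≤ t (2≤2^[1+a] a)) ⟩
  2 ^ suc a + 2 ^ suc a * t   ≡⟨ sym (ℕ.*-suc (2 ^ suc a) t) ⟩
  2 ^ suc a * suc t           ∎
  where open ℕ.≤-Reasoning

2*[3+b]+2≤2^[3+b] : ∀ b → 2 * (3 + b) + 2 ≤ 2 ^ (3 + b)
2*[3+b]+2≤2^[3+b] zero    = ℕ.≤-refl
2*[3+b]+2≤2^[3+b] (suc b) = begin
  2 * (4 + b) + 2            ≡⟨ cong (_+ 2) (ℕ.*-suc 2 (3 + b)) ⟩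
  2 + 2 * (3 + b) + 2        ≡⟨ ℕ.+-assoc 2 (2 * (3 + b)) 2 ⟩
  2 + (2 * (3 + b) + 2)      ≤⟨ ℕ.+-mono-≤ (2≤2^[1+a] (2 + b)) (2*[3+b]+2≤2^[3+b] b) ⟩
  2 ^ (3 + b) + 2 ^ (3 + b)  ≡⟨ cong (2 ^ (3 + b) +_) (sym (ℕ.+-identityʳ _)) ⟩
  2 ^ (4 + b)                ∎
  where open ℕ.≤-Reasoning

2[c+a+m]∸1≤2^a[1+d]+m : ∀ a m c d → c ≤ 2 → c + m ≤ d → 2 * (c + (a + m)) ∸ 1 ≤ 2 ^ a * suc d + m
2[c+a+m]∸1≤2^a[1+d]+m zero m c d c≤2 c+m≤d = ℕ.m≤n+o⇒m∸n≤o _ 1 (begin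
  2 * (c + m)              ≡⟨ cong ((c + m) +_) (ℕ.+-identityʳ (c + m)) ⟩
  (c + m) + (c + m)        ≡⟨ ℕ.+-assoc c m (c + m) ⟩
  c + (m + (c + m))        ≡⟨ cong (c +_) (ℕ.+-comm m (c + m)) ⟩
  c + ((c + m) + m)        ≤⟨ ℕ.+-mono-≤ c≤2 (ℕ.+-monoˡ-≤ m c+m≤d) ⟩
  2 + (d + m)              ≡⟨ cong (λ t → 2 + (t + m)) (sym (ℕ.+-identityʳ d)) ⟩
  1 + (1 * suc d + m)      ∎)
  where open ℕ.≤-Reasoning
2[c+a+m]∸1≤2^a[1+d]+m (suc a) m c d c≤2 c+m≤d = begin
  2 * (c + (suc a + m)) ∸ 1  ≤⟨ ℕ.m∸n≤m _ 1 ⟩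
  2 * (c + (suc a + m))      ≡⟨ cong (2 *_) (x∙yz≈y∙xz c (suc a) m) ⟩
  2 * (suc a + (c + m))      ≤⟨ 2*[a+t]≤2^a*[1+t] (suc a) (c + m) (s≤s z≤n) ⟩
  2 ^ suc a * suc (c + m)    ≤⟨ ℕ.*-monoʳ-≤ (2 ^ suc a) (s≤s c+m≤d) ⟩
  2 ^ suc a * suc d          ≤⟨ ℕ.m≤m+n _ m ⟩
  2 ^ suc a * suc d + m      ∎
  where open ℕ.≤-Reasoning

2[1+a+m]∸1≤2^a[1+d]+m : ∀ a m d → 2 ≤ a + m → ¬ (a ≡ 2 × m ≡ 0) → m ≤ d →
                        2 * suc (a + m) ∸ 1 ≤ 2 ^ a * suc d + m
2[1+a+m]∸1≤2^a[1+d]+m a m d 2≤a+m ¬exceptional m≤d = ℕ.m≤n+o⇒m∸n≤o _ 1 (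
  ℕ.≤-trans (ℕ.≤-reflexive (ℕ.*-suc 2 (a + m))) (s≤s (1+2[a+m]≤2^a[1+d]+m a m 2≤a+m ¬exceptional m≤d)))
  where
  open ℕ.≤-Reasoning
  1+2[a+m]≤2^a[1+d]+m : ∀ a m → 2 ≤ a + m → ¬ (a ≡ 2 × m ≡ 0) → m ≤ d → suc (2 * (a + m)) ≤ 2 ^ a * suc d + m
  1+2[a+m]≤2^a[1+d]+m (suc zero)       zero (s≤s ()) _ _
  1+2[a+m]≤2^a[1+d]+m (suc (suc zero)) zero _ ¬exceptional _ = contradiction (refl , refl) ¬exceptional
  1+2[a+m]≤2^a[1+d]+m (suc (suc (suc b))) zero _ _ _ = begin
    suc (2 * (3 + b + 0))      ≡⟨ cong (λ t → suc (2 * t)) (ℕ.+-identityʳ (3 + b)) ⟩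
    suc (2 * (3 + b))          ≤⟨ ℕ.n≤1+n _ ⟩
    2 + 2 * (3 + b)            ≡⟨ ℕ.+-comm 2 _ ⟩
    2 * (3 + b) + 2            ≤⟨ 2*[3+b]+2≤2^[3+b] b ⟩
    2 ^ (3 + b)                ≤⟨ ℕ.m≤m*n (2 ^ (3 + b)) (suc d) ⟩
    2 ^ (3 + b) * suc d        ≡⟨ sym (ℕ.+-identityʳ _) ⟩
    2 ^ (3 + b) * suc d + 0    ∎
  1+2[a+m]≤2^a[1+d]+m zero (suc m) _ _ m≤d = begin
    suc (2 * suc m)            ≡⟨ cong (λ t → suc (suc m + t)) (ℕ.+-identityʳ (suc m)) ⟩
    suc (suc m + suc m)        ≤⟨ s≤s (ℕ.+-monoˡ-≤ (suc m) m≤d) ⟩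
    suc d + suc m              ≡⟨ cong (_+ suc m) (sym (ℕ.+-identityʳ (suc d))) ⟩
    1 * suc d + suc m          ∎
  1+2[a+m]≤2^a[1+d]+m (suc a) (suc m) _ _ m≤d = begin
    suc (2 * (suc a + suc m))      ≤⟨ s≤s (2*[a+t]≤2^a*[1+t] (suc a) (suc m) (s≤s z≤n)) ⟩
    suc (2 ^ suc a * suc (suc m))  ≤⟨ s≤s (ℕ.*-monoʳ-≤ (2 ^ suc a) (s≤s m≤d)) ⟩
    suc (2 ^ suc a * suc d)        ≡⟨ ℕ.+-comm 1 _ ⟩
    2 ^ suc a * suc d + 1          ≤⟨ ℕ.+-monoʳ-≤ (2 ^ suc a * suc d) (s≤s z≤n) ⟩
    2 ^ suc a * suc d + suc m      ∎


-- The families of subgraphs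

module Bound {n} (G : Graph n) (conn : ConnectedGraph G) (C : Subset n)
             (cuts : ∀ w → (w ∈ C → IsCutVertex G w) × (IsCutVertex G w → w ∈ C))
             (3≤∣∁C∣ : 3 ≤ ∣ ∁ C ∣) (u v : Fin n) where

  3≤n : 3 ≤ n
  3≤n = ℕ.≤-trans 3≤∣∁C∣ (∣p∣≤n (∁ C))

  noncut : w ∈ ∁ C → ¬ IsCutVertex G w
  noncut w∈∁C = x∈∁p⇒x∉p w∈∁C ∘ proj₂ (cuts _)

  ends pendants inner inner′ : Subset n
  ends     = ⁅ u ⁆ ∪ ⁅ v ⁆
  pendants = (∁ C ─ ends) ∩ leaves G
  inner    = ∁ C ─ leaves G
  inner′   = inner ─ ends

  u∈ends : u ∈ ends
  u∈ends = x∈p∪q⁺ (inj₁ (x∈⁅x⁆ u))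

  v∈ends : v ∈ ends
  v∈ends = x∈p∪q⁺ (inj₂ (x∈⁅x⁆ v))

  pendant-leaf : w ∈ pendants → IsLeaf G w
  pendant-leaf w∈ = ∈leaves⁻ G (proj₂ (x∈p∩q⁻ _ _ w∈))

  pendant-noncut : w ∈ pendants → w ∈ ∁ C
  pendant-noncut w∈ = p─q⊆p _ _ (proj₁ (x∈p∩q⁻ _ _ w∈))

  pendant-∉ends : w ∈ pendants → w ∉ ends
  pendant-∉ends w∈ = x∈p─q⇒x∉q (proj₁ (x∈p∩q⁻ _ _ w∈))

  inner-¬leaf : w ∈ inner → ¬ IsLeaf G w
  inner-¬leaf w∈ = x∈p─q⇒x∉q w∈ ∘ ∈leaves⁺ G

  inner-noncut : w ∈ inner → w ∈ ∁ C
  inner-noncut = p─q⊆p _ _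

  ∣∁C∣≡c+a+m : ∣ ∁ C ∣ ≡ ∣ ∁ C ∩ ends ∣ + (∣ pendants ∣ + ∣ inner′ ∣)
  ∣∁C∣≡c+a+m = begin
    ∣ ∁ C ∣
      ≡⟨ ∣p∣≡∣p∩q∣+∣p─q∣ (∁ C) ends ⟩
    ∣ ∁ C ∩ ends ∣ + ∣ ∁ C ─ ends ∣
      ≡⟨ cong (∣ ∁ C ∩ ends ∣ +_) (∣p∣≡∣p∩q∣+∣p─q∣ (∁ C ─ ends) (leaves G)) ⟩
    ∣ ∁ C ∩ ends ∣ + (∣ pendants ∣ + ∣ ∁ C ─ ends ─ leaves G ∣)
      ≡⟨ cong (λ p → ∣ ∁ C ∩ ends ∣ + (∣ pendants ∣ + ∣ p ∣)) (p─q─r≡p─r─q (∁ C) ends (leaves G)) ⟩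
    ∣ ∁ C ∩ ends ∣ + (∣ pendants ∣ + ∣ inner′ ∣) ∎
    where open ≡-Reasoning

  Index : Set
  Index = Subset n × Maybe (Fin n × Fin n)

  ValidIndex : Index → Set
  ValidIndex (S , ε) = VisibleIn G S ε × ConnSubThrough G u v (pruned G S ε)

  at-least-indices : ∀ {I} → Unique I → All ValidIndex I → ConnSubsThroughAtLeast G u v (length I)
  at-least-indices {I} uI I-valid = subst (ConnSubsThroughAtLeast G u v) (length-map _ I) $
    at-least-length G (map-unique-on (λ i-valid j-valid → pruned-injective G (proj₁ i-valid) (proj₁ j-valid))
                                     I-valid uI)
                      (All.map⁺ (All.map proj₂ I-valid))

  private variable
    S : Subset n
    D : List (Fin n × Fin n)

  meeting-edge : ∀ {e} → EdgeMeeting G inner e →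
                 ¬ IsLeaf G (proj₁ e) × ¬ IsLeaf G (proj₂ e) × (∀ x y → Walk (Kept G (just e)) x y)
  meeting-edge {a , b} (a~b , _ , inj₁ a∈) =
    inner-¬leaf a∈ ,
    noncut-neighbour-¬leaf G 3≤n (noncut (inner-noncut a∈)) a~b ,
    edge-deletion-connected G (noncut (inner-noncut a∈)) (inner-¬leaf a∈) b
  meeting-edge {a , b} (a~b , _ , inj₂ b∈) =
    noncut-neighbour-¬leaf G 3≤n (noncut (inner-noncut b∈)) (Adj-sym G a~b) ,
    inner-¬leaf b∈ ,
    λ x y → mapʷ (Product.map₂ (Keeps-swap (b , a)))
                 (edge-deletion-connected G (noncut (inner-noncut b∈)) (inner-¬leaf b∈) a x y)

  private
    ¬leaf∉ : S ⊆ pendants → ¬ IsLeaf G w → w ∉ S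
    ¬leaf∉ S⊆ ¬leaf w∈S = ¬leaf (pendant-leaf (S⊆ w∈S))

    end∉ : S ⊆ pendants → w ∈ ends → w ∉ S
    end∉ S⊆ w∈ends w∈S = pendant-∉ends (S⊆ w∈S) w∈ends

  pruning-valid : ∀ {ε} → S ⊆ pendants → Maybe.All (EdgeMeeting G inner) ε → ValidIndex (S , ε)
  pruning-valid S⊆ nothing =
    tt , leaves-pruned-through G nothing (pendant-leaf ∘ S⊆) (end∉ S⊆ u∈ends) (end∉ S⊆ v∈ends)
                                 (λ a b → mapʷ (_, tt) (conn a b))
  pruning-valid {ε = just e} S⊆ (just e-meets) =
    let ¬leaf₁ , ¬leaf₂ , walks = meeting-edge e-meets in
    (¬leaf∉ S⊆ ¬leaf₁ , ¬leaf∉ S⊆ ¬leaf₂ , proj₁ e-meets , proj₁ (proj₂ e-meets)) ,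
    leaves-pruned-through G (just e) (pendant-leaf ∘ S⊆) (end∉ S⊆ u∈ends) (end∉ S⊆ v∈ends) walks

  prunings : List (Fin n × Fin n) → List Index
  prunings D = List.cartesianProduct (subsetsOf pendants) (nothing ∷ map just D)

  prunings-⊆ : All ((_⊆ pendants) ∘ proj₁) (prunings D)
  prunings-⊆ = All.cartesianProduct⁺ (setoid _) (setoid _) _ _ λ S∈ _ → All.lookup (subsetsOf-⊆ pendants) S∈

  prunings-valid : All (EdgeMeeting G inner) D → All ValidIndex (prunings D)
  prunings-valid {D} D-meet = All.cartesianProduct⁺ (setoid _) (setoid _) _ _ λ S∈ ε∈ →
    pruning-valid (All.lookup (subsetsOf-⊆ pendants) S∈) (All.lookup optional-meets ε∈)
    where
    optional-meets : All (Maybe.All (EdgeMeeting G inner)) (nothing ∷ map just D)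
    optional-meets = nothing ∷ All.map⁺ (All.map just D-meet)

  prunings-unique : Unique D → Unique (prunings D)
  prunings-unique uD = Unique.cartesianProduct⁺ (subsetsOf-unique pendants)
    (All.map⁺ (All.tabulate λ _ ()) ∷ Unique.map⁺ Maybe.just-injective uD)

  length-prunings : length (prunings D) ≡ 2 ^ ∣ pendants ∣ * suc (length D)
  length-prunings {D} = trans (length-cartesianProduct (subsetsOf pendants) (nothing ∷ map just D))
    (cong₂ _*_ (length-subsetsOf pendants) (cong suc (length-map just D)))

  deletions : List Index
  deletions = map (λ w → ⁅ w ⁆ , nothing) (elements inner′)

  deletions-⊈ : All (¬_ ∘ (_⊆ pendants) ∘ proj₁) deletions
  deletions-⊈ = All.map⁺ (All.map (λ w∈ ⁅w⁆⊆ → inner-¬leaf (p─q⊆p _ _ w∈) (pendant-leaf (⁅w⁆⊆ (x∈⁅x⁆ _))))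
                                  (elements-∈ inner′))

  deletions-valid : All ValidIndex deletions
  deletions-valid = All.map⁺ (All.map (λ w∈ → tt , deletion-through G (noncut (inner-noncut (p─q⊆p _ _ w∈)))
                                                    (end≢ (x∈p─q⇒x∉q w∈) u∈ends) (end≢ (x∈p─q⇒x∉q w∈) v∈ends))
                                      (elements-∈ inner′))
    where
    end≢ : w ∉ ends → x ∈ ends → x ≢ w
    end≢ w∉ x∈ refl = w∉ x∈

  deletions-unique : Unique deletions
  deletions-unique = Unique.map⁺ (⁅⁆-injective ∘ cong proj₁) (elements-unique inner′)

  pruning-family : Unique D → All (EdgeMeeting G inner) D →
                   ConnSubsThroughAtLeast G u v (2 ^ ∣ pendants ∣ * suc (length D) + ∣ inner′ ∣)
  pruning-family {D} uD D-meet = subst (ConnSubsThroughAtLeast G u v) length-indices $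
    at-least-indices
      (Unique.++⁺ (prunings-unique uD) deletions-unique (disjoint-by prunings-⊆ deletions-⊈))
      (All.++⁺ (prunings-valid D-meet) deletions-valid)
    where
    length-indices : length (prunings D ++ deletions) ≡ 2 ^ ∣ pendants ∣ * suc (length D) + ∣ inner′ ∣
    length-indices = trans (length-++ (prunings D))
      (cong₂ _+_ length-prunings (trans (length-map _ (elements inner′)) (length-elements inner′)))

  -- The subgraph on {u, v} is G - ∁ ends, which is new unless ∁ ends consists of pendant vertices.
  pair-family : u ≡ v ⊎ Adj G u v → ¬ (∁ ends ⊆ pendants) →
                ConnSubsThroughAtLeast G u v (suc (2 ^ ∣ pendants ∣))
  pair-family u≈v ∁ends⊈ =
    subst (ConnSubsThroughAtLeast G u v) (cong suc (trans length-prunings (ℕ.*-identityʳ _))) $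
    at-least-indices
      (All.map (λ S⊆ eq → ∁ends⊈ (subst (_⊆ pendants) (sym (cong proj₁ eq)) (λ {x} → S⊆ {x}))) prunings-⊆ ∷
       prunings-unique [])
      ((tt , pair-through G u≈v) ∷ prunings-valid [])

  without-leaf-end : ¬ (u ∈ ∁ C × IsLeaf G u) → ¬ (v ∈ ∁ C × IsLeaf G v) →
                     ConnSubsThroughAtLeast G u v (2 * ∣ ∁ C ∣ ∸ 1)
  without-leaf-end ¬u ¬v =
    let D , uD , D-meet , ∣inner∣≤∣D∣ = edges-meeting G inner inner-¬leaf in
    at-least-≤ G (subst (λ t → 2 * t ∸ 1 ≤ 2 ^ ∣ pendants ∣ * suc (length D) + ∣ inner′ ∣) (sym ∣∁C∣≡c+a+m)
                        (2[c+a+m]∸1≤2^a[1+d]+m (∣ pendants ∣) (∣ inner′ ∣) (∣ ∁ C ∩ ends ∣) (length D)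
                                               c≤2 (ℕ.≤-trans c+m≤∣inner∣ ∣inner∣≤∣D∣)))
                 (pruning-family uD D-meet)
    where
    c≤2 : ∣ ∁ C ∩ ends ∣ ≤ 2
    c≤2 = ℕ.≤-trans (∣p∩q∣≤∣q∣ (∁ C) ends) (∣⁅x⁆∪⁅y⁆∣≤2 u v)

    end-not-noncut-leaf : x ∈ ends → ¬ (x ∈ ∁ C × IsLeaf G x)
    end-not-noncut-leaf x∈ends = Sum.[ (λ { refl → ¬u }) , (λ { refl → ¬v }) ] (x∈⁅y⁆∪⁅z⁆⇒ x∈ends)

    noncut-ends⊆inner : ∁ C ∩ ends ⊆ inner ∩ ends
    noncut-ends⊆inner x∈ =
      let x∈∁C , x∈ends = x∈p∩q⁻ _ _ x∈
      in x∈p∩q⁺ (x∈p∧x∉q⇒x∈p─q x∈∁C (λ x∈L → end-not-noncut-leaf x∈ends (x∈∁C , ∈leaves⁻ G x∈L)) , x∈ends)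

    c+m≤∣inner∣ : ∣ ∁ C ∩ ends ∣ + ∣ inner′ ∣ ≤ ∣ inner ∣
    c+m≤∣inner∣ = ℕ.≤-trans (ℕ.+-monoˡ-≤ _ (p⊆q⇒∣p∣≤∣q∣ noncut-ends⊆inner))
                             (ℕ.≤-reflexive (sym (∣p∣≡∣p∩q∣+∣p─q∣ inner ends)))

  private
    outside-ends-pendant : ∁ ends ⊆ pendants → z ≢ u → z ≢ v → z ∈ pendants
    outside-ends-pendant ∁ends⊆ z≢u z≢v =
      ∁ends⊆ (x∉p⇒x∈∁p (Sum.[ z≢u , z≢v ] ∘ x∈⁅y⁆∪⁅z⁆⇒))

    pendants-fill⇒n≡4 : ∁ ends ⊆ pendants → ∣ pendants ∣ ≡ 2 → v ∈ C → n ≡ 4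
    pendants-fill⇒n≡4 ∁ends⊆ ∣pendants∣≡2 v∈C = ℕ.≤-antisym n≤4 4≤n
      where
      open ℕ.≤-Reasoning

      ⊤⊆ : ⊤ {n} ⊆ ends ∪ pendants
      ⊤⊆ {z} _ with z ∈? ends
      ... | yes z∈ = x∈p∪q⁺ (inj₁ z∈)
      ... | no  z∉ = x∈p∪q⁺ (inj₂ (∁ends⊆ (x∉p⇒x∈∁p z∉)))

      n≤4 : n ≤ 4
      n≤4 = begin
        n                        ≡⟨ ∣⊤∣≡n n ⟨
        ∣ ⊤ {n} ∣                ≤⟨ p⊆q⇒∣p∣≤∣q∣ ⊤⊆ ⟩
        ∣ ends ∪ pendants ∣      ≤⟨ ∣p∪q∣≤∣p∣+∣q∣ ends pendants ⟩
        ∣ ends ∣ + ∣ pendants ∣  ≤⟨ ℕ.+-mono-≤ (∣⁅x⁆∪⁅y⁆∣≤2 u v) (ℕ.≤-reflexive ∣pendants∣≡2) ⟩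
        4                        ∎

      4≤n : 4 ≤ n
      4≤n = begin
        1 + 3                ≤⟨ ℕ.+-mono-≤ (x∈p⇒0<∣p∣ v∈C) 3≤∣∁C∣ ⟩
        ∣ C ∣ + ∣ ∁ C ∣      ≡⟨ cong (∣ C ∣ +_) (∣∁p∣≡n∸∣p∣ C) ⟩
        ∣ C ∣ + (n ∸ ∣ C ∣)  ≡⟨ ℕ.m+[n∸m]≡n (∣p∣≤n C) ⟩
        n                    ∎

  module _ (u∈∁C : u ∈ ∁ C) (u-leaf : IsLeaf G u) (u≈v : u ≡ v ⊎ Adj G u v) where

    pendants-fill⇒K13 : ∁ ends ⊆ pendants → ∣ pendants ∣ ≡ 2 → Iso G K13
    pendants-fill⇒K13 ∁ends⊆ ∣pendants∣≡2 = Sum.[ ⊥-elim ∘ ¬u≡v , star ] u≈v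
      where
      ¬u≡v : u ≢ v
      ¬u≡v u≡v =
        let z , z≢u , _ = 3≤n⇒∃≢₂ 3≤n u u
            y , u~y     = first-step (conn u z) (z≢u ∘ sym)
            y≢u         = Adj-irrefl G u~y ∘ sym
        in noncut-neighbour-¬leaf G 3≤n (noncut u∈∁C) u~y
             (pendant-leaf (outside-ends-pendant ∁ends⊆ y≢u (y≢u ∘ flip trans (sym u≡v))))

      star : Adj G u v → Iso G K13
      star u~v = star⇒K13 G (pendants-fill⇒n≡4 ∁ends⊆ ∣pendants∣≡2 v∈C) v
                            (leaves-around⇒star G conn 3≤n v noncut-leaf)
        where
        v∈C : v ∈ C
        v∈C = proj₂ (cuts v) (leaf-neighbour-cut G 3≤n u-leaf u~v)

        noncut-leaf : z ≢ v → ¬ IsCutVertex G z × IsLeaf G z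
        noncut-leaf {z} z≢v with z Fin.≟ u
        ... | yes refl = noncut u∈∁C , u-leaf
        ... | no  z≢u  = let z∈ = outside-ends-pendant ∁ends⊆ z≢u z≢v
                         in noncut (pendant-noncut z∈) , pendant-leaf z∈

    noncut-ends⊆⁅u⁆ : ∁ C ∩ ends ⊆ ⁅ u ⁆
    noncut-ends⊆⁅u⁆ {x} x∈ with x∈p∩q⁻ _ _ x∈
    ... | x∈∁C , x∈ends with x∈⁅y⁆∪⁅z⁆⇒ x∈ends
    ... | inj₁ refl = x∈⁅x⁆ u
    ... | inj₂ refl = Sum.[ (λ u≡x → subst (λ t → x ∈ ⁅ t ⁆) (sym u≡x) (x∈⁅x⁆ x)) , x-cut ] u≈v
      where
      x-cut : Adj G u x → x ∈ ⁅ u ⁆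
      x-cut u~x = contradiction (proj₂ (cuts x) (leaf-neighbour-cut G 3≤n u-leaf u~x)) (x∈∁p⇒x∉p x∈∁C)

    ∣∁C∣≤1+a+m : ∣ ∁ C ∣ ≤ suc (∣ pendants ∣ + ∣ inner′ ∣)
    ∣∁C∣≤1+a+m = ℕ.≤-trans (ℕ.≤-reflexive ∣∁C∣≡c+a+m)
      (ℕ.+-monoˡ-≤ _ (ℕ.≤-trans (p⊆q⇒∣p∣≤∣q∣ noncut-ends⊆⁅u⁆) (ℕ.≤-reflexive (∣⁅x⁆∣≡1 u))))

    with-leaf-end : ¬ Iso G K13 → ConnSubsThroughAtLeast G u v (2 * ∣ ∁ C ∣ ∸ 1)
    with-leaf-end ¬K13 with (∣ pendants ∣ ℕ.≟ 2) ×-dec (∣ inner′ ∣ ℕ.≟ 0)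
    ... | yes (a≡2 , m≡0) =
      at-least-≤ G (subst (λ a → 2 * ∣ ∁ C ∣ ∸ 1 ≤ suc (2 ^ a)) (sym a≡2)
                          (ℕ.∸-monoˡ-≤ 1 (ℕ.*-monoʳ-≤ 2 ∣∁C∣≤3)))
                   (pair-family u≈v (λ ∁ends⊆ → ¬K13 (pendants-fill⇒K13 ∁ends⊆ a≡2)))
      where
      ∣∁C∣≤3 : ∣ ∁ C ∣ ≤ 3
      ∣∁C∣≤3 = subst (λ t → ∣ ∁ C ∣ ≤ suc t) (cong₂ _+_ a≡2 m≡0) ∣∁C∣≤1+a+m
    ... | no ¬exceptional =
      let D , uD , D-meet , ∣inner∣≤∣D∣ = edges-meeting G inner inner-¬leaf in
      at-least-≤ G (ℕ.≤-trans (ℕ.∸-monoˡ-≤ 1 (ℕ.*-monoʳ-≤ 2 ∣∁C∣≤1+a+m))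
                              (2[1+a+m]∸1≤2^a[1+d]+m (∣ pendants ∣) (∣ inner′ ∣) (length D)
                                 (ℕ.≤-pred (ℕ.≤-trans 3≤∣∁C∣ ∣∁C∣≤1+a+m)) ¬exceptional
                                 (ℕ.≤-trans (∣p─q∣≤∣p∣ inner ends) ∣inner∣≤∣D∣)))
                   (pruning-family uD D-meet)

proposition3p6 : (n k : ℕ) → k + 3 ≤ n → (G : Graph n) → ConnectedGraph G →
    HasExactlyCutVertices G k → ¬ Iso G K13 →
    (B : Sub n) → IsBlock G B → (u v : Fin n) → u ∈ verts B → v ∈ verts B →
    ConnSubsThroughAtLeast G u v (2 * (n ∸ k) ∸ 1)
proposition3p6 n k k+3≤n G conn (C , ∣C∣≡k , cuts) ¬K13 B B-block u v u∈B v∈B =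
  subst (λ t → ConnSubsThroughAtLeast G u v (2 * t ∸ 1)) ∣∁C∣≡n∸k (by-cases (noncut-leaf? u) (noncut-leaf? v))
  where
  ∣∁C∣≡n∸k : ∣ ∁ C ∣ ≡ n ∸ k
  ∣∁C∣≡n∸k = trans (∣∁p∣≡n∸∣p∣ C) (cong (n ∸_) ∣C∣≡k)

  3≤∣∁C∣ : 3 ≤ ∣ ∁ C ∣
  3≤∣∁C∣ = subst (3 ≤_) (sym ∣∁C∣≡n∸k) (ℕ.m+n≤o⇒m≤o∸n 3 (subst (_≤ n) (ℕ.+-comm k 3) k+3≤n))

  noncut-leaf? : ∀ x → Dec (x ∈ ∁ C × IsLeaf G x)
  noncut-leaf? x = x ∈? ∁ C ×-dec degree G x ℕ.≤? 1

  leaf-end : x ∈ verts B → y ∈ verts B → IsLeaf G x → x ≡ y ⊎ Adj G x y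
  leaf-end {x} {y} x∈B y∈B x-leaf with x Fin.≟ y
  ... | yes x≡y = inj₁ x≡y
  ... | no  x≢y = inj₂ (block-leaf-adjacent G B-block x∈B y∈B x≢y x-leaf)

  by-cases : Dec (u ∈ ∁ C × IsLeaf G u) → Dec (v ∈ ∁ C × IsLeaf G v) →
             ConnSubsThroughAtLeast G u v (2 * ∣ ∁ C ∣ ∸ 1)
  by-cases (yes (u∈∁C , u-leaf)) _ =
    Bound.with-leaf-end G conn C cuts 3≤∣∁C∣ u v u∈∁C u-leaf (leaf-end u∈B v∈B u-leaf) ¬K13
  by-cases (no _) (yes (v∈∁C , v-leaf)) =
    at-least-swap G (Bound.with-leaf-end G conn C cuts 3≤∣∁C∣ v u v∈∁C v-leaf (leaf-end v∈B u∈B v-leaf) ¬K13)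
  by-cases (no ¬u) (no ¬v) = Bound.without-leaf-end G conn C cuts 3≤∣∁C∣ u v ¬u ¬v
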